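{- Let $k \ge 3$ be an integer. Then for all $n \ge k$, $$|S_n(R^k_{k-1,k-1})| = (k-2)!\, ( F_{n-k+4} + (k-3) F_{n-k+2} ).$$
   Context: $S_n$ is the set of permutations of $\{1,\dots,n\}$ in one-line notation; $\pi$ avoids $\sigma\in S_k$ if no subsequence of $\pi$ of length $k$ has the same relative order as $\sigma$; $S_n(R)$ is the set of $\pi\in S_n$ avoiding every element of $R$. For a sequence $a_1,\dots,a_l$ of positive integers ($l\le k$), a permutation $\sigma \in S_k$ agrees with it to length $j$ if $\sigma(i)=a_i$ for $1\le i\le j$ (to length $0$ if $\sigma(1)\ne a_1$); $R^k_{a_1,\ldots,a_l}$ is the set of $\sigma \in S_k$ such that either $\sigma$ agrees with $a_1,\dots,a_l$ to length $l$, or for some $0\le i\le l-1$, $\sigma$ agrees with it to length $i$ and $\sigma(i+1)<a_{i+1}$. Thus $R^k_{k-1,k-1}$ is the set of $\sigma\in S_k$ with $\sigma(1)<k-1$, or with $\sigma(1)=k-1$ and $\sigma(2)<k-1$. $F_n$ denotes the Fibonacci numbers, $F_0=0$, $F_1=1$, $F_n=F_{n-1}+F_{n-2}$. -}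

module Defs where

open import Data.Nat using (ℕ; zero; suc; _+_; _<_)
open import Data.Fin using (Fin; toℕ) renaming (zero to fzero; suc to fsuc; _<_ to _<ᶠ_)
open import Data.Vec using (Vec; lookup)
open import Data.Product using (Σ; _×_)
open import Data.Sum using (_⊎_)
open import Data.Empty using (⊥)
open import Relation.Nullary using (¬_)
open import Relation.Binary.PropositionalEquality using (_≡_)

F : ℕ → ℕ
F zero = zero
F (suc zero) = suc zero
F (suc (suc n)) = F (suc n) + F n

-- A permutation of {1..n} in one-line notation is a vector v of length n with
-- entries in Fin n (value i+1 is represented by the Fin element i) which is injective.
IsPerm : (n : ℕ) → Vec (Fin n) n → Set
IsPerm n v = (i j : Fin n) → lookup v i ≡ lookup v j → i ≡ j

Contains : {n k : ℕ} → Vec (Fin n) n → Vec (Fin k) k → Set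
Contains {n} {k} π σ =
  Σ (Fin k → Fin n) λ e →
    ((i j : Fin k) → i <ᶠ j → e i <ᶠ e j) ×
    ((i j : Fin k) →
      ((lookup σ i <ᶠ lookup σ j → lookup π (e i) <ᶠ lookup π (e j)) ×
       (lookup π (e i) <ᶠ lookup π (e j) → lookup σ i <ᶠ lookup σ j)))

-- Membership in R^k_{k-1,k-1} (for permutations σ ∈ S_k; values 0-indexed, so the
-- paper's value k-1 is the Fin element with toℕ = k-2):
-- σ(1) < k-1, or σ(1) = k-1 and σ(2) < k-1.
-- (For k < 2 the set is not used; it is taken empty.)
InR : (k : ℕ) → Vec (Fin k) k → Set
InR zero σ = ⊥
InR (suc zero) σ = ⊥
InR (suc (suc m)) σ =
  (toℕ (lookup σ fzero) < m) ⊎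
  ((toℕ (lookup σ fzero) ≡ m) × (toℕ (lookup σ (fsuc fzero)) < m))

AvoidsR : (n k : ℕ) → Vec (Fin n) n → Set
AvoidsR n k π = (σ : Vec (Fin k) k) → IsPerm k σ → InR k σ → ¬ Contains π σ

-- S_n(R^k_{k-1,k-1}) as a type; the proof fields are irrelevant, so two elements
-- are equal iff their underlying one-line vectors are equal.
record SnR (n k : ℕ) : Set where
  constructor mkSnR
  field
    perm : Vec (Fin n) n
    .isPerm : IsPerm n perm
    .avoids : AvoidsR n k perm

-- Write k = m + 2 and count values from 0, so that R consists of the σ ∈ S_k whose first entry
-- is below m, or equals m and is followed by an entry below m. Every such σ has an entry larger
-- than its first one at a position other than the second. Hence prepending the largest value to
-- an avoider, or the two largest values in increasing order, yields an avoider. Conversely an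
-- avoider of length M + 2 with M ≥ m must start in one of these two ways: otherwise deleting
-- entries of value 0 or 1 away from the first two positions lowers M while keeping the start bad,
-- and at M = m the permutation itself lies in R. So a(M + 2) = a(M + 1) + a(M) for M ≥ m, while
-- a(n) = n! for n < k, and the formula is the solution of this recurrence from m! and (m + 1)!.

module Submission where

open import Defs
open import Data.Nat using (ℕ; _+_; _*_; _∸_; _≤_; _!)
open import Data.Fin using (Fin)
open import Function.Bundles using (_↔_)

open import Data.Nat using (zero; suc; z≤n; s≤s; _<_; s≤s⁻¹)
import Data.Nat.Properties as ℕP
open import Data.Nat.Solver using (module +-*-Solver)
open import Data.Fin using (toℕ; fromℕ; inject₁; punchIn; punchOut; _≟_)
  renaming (zero to fzero; suc to fsuc; _<_ to _<ᶠ_)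
import Data.Fin.Properties as FP
open import Data.Vec using (Vec; []; lookup; tabulate)
open import Data.Vec.Properties using (lookup∘tabulate; tabulate∘lookup; tabulate-cong)
open import Data.Product using (Σ; ∃; _×_; _,_; proj₁; proj₂)
open import Data.Sum using (_⊎_; inj₁; inj₂)
open import Data.Empty using (⊥)
import Data.Empty.Irrelevant as Irrelevant
open import Function using (_∘_)
open import Function.Definitions using (Injective)
open import Function.Bundles using (mk↔ₛ′)
open import Function.Construct.Composition using (_↔-∘_)
open import Function.Construct.Symmetry using (↔-sym)
open import Function.Construct.Identity using (↔-id)
open import Data.Product.Function.NonDependent.Propositional using (_×-↔_)
open import Data.Sum.Function.Propositional using (_⊎-↔_)
open import Relation.Nullary using (¬_; yes; no; contradiction)
open import Relation.Nullary.Decidable using (Dec; _×-dec_; _⊎-dec_)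
open import Relation.Binary.Definitions using (tri<; tri≈; tri>)
open import Relation.Binary.PropositionalEquality
  using (_≡_; _≢_; _≗_; refl; sym; trans; cong; cong₂; subst; subst₂; module ≡-Reasoning)

punchIn-mono-< : ∀ {n} (i : Fin (suc n)) {x y : Fin n} → x <ᶠ y → punchIn i x <ᶠ punchIn i y
punchIn-mono-< i {x} {y} x<y = ℕP.≰⇒> (ℕP.<⇒≱ x<y ∘ FP.punchIn-cancel-≤ i y x)

punchIn-cancel-< : ∀ {n} (i : Fin (suc n)) {x y : Fin n} → punchIn i x <ᶠ punchIn i y → x <ᶠ y
punchIn-cancel-< i {x} {y} lt = ℕP.≰⇒> (ℕP.<⇒≱ lt ∘ FP.punchIn-mono-≤ i y x)

punchOut-mono-< : ∀ {n} {i x y : Fin (suc n)} (i≢x : i ≢ x) (i≢y : i ≢ y) →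
  x <ᶠ y → punchOut i≢x <ᶠ punchOut i≢y
punchOut-mono-< i≢x i≢y x<y = ℕP.≰⇒> (ℕP.<⇒≱ x<y ∘ FP.punchOut-cancel-≤ i≢y i≢x)

punchOut-cancel-< : ∀ {n} {i x y : Fin (suc n)} (i≢x : i ≢ x) (i≢y : i ≢ y) →
  punchOut i≢x <ᶠ punchOut i≢y → x <ᶠ y
punchOut-cancel-< i≢x i≢y lt = ℕP.≰⇒> (ℕP.<⇒≱ lt ∘ FP.punchOut-mono-≤ i≢y i≢x)

punchOut-cong₂ : ∀ {n} {i i′ j j′ : Fin (suc n)} {i≢j : i ≢ j} {i′≢j′ : i′ ≢ j′} →
  i ≡ i′ → j ≡ j′ → punchOut i≢j ≡ punchOut i′≢j′
punchOut-cong₂ {i = i} refl j≡j′ = FP.punchOut-cong i j≡j′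

toℕ-punchOut-< : ∀ {n} {i j : Fin (suc n)} (i≢j : i ≢ j) → j <ᶠ i → toℕ (punchOut i≢j) ≡ toℕ j
toℕ-punchOut-< {suc n} {fsuc i} {fzero} _ _ = refl
toℕ-punchOut-< {suc n} {fsuc i} {fsuc j} i≢j (s≤s j<i) =
  cong suc (toℕ-punchOut-< (i≢j ∘ cong fsuc) j<i)

toℕ-punchOut-> : ∀ {n} {i j : Fin (suc n)} (i≢j : i ≢ j) → i <ᶠ j → suc (toℕ (punchOut i≢j)) ≡ toℕ j
toℕ-punchOut-> {_} {fzero} {fsuc j} _ _ = refl
toℕ-punchOut-> {suc n} {fsuc i} {fsuc j} i≢j (s≤s i<j) =
  cong suc (toℕ-punchOut-> (i≢j ∘ cong fsuc) i<j)

penultimate : ∀ n → Fin (suc (suc n))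
penultimate n = inject₁ (fromℕ n)

toℕ-penultimate : ∀ n → toℕ (penultimate n) ≡ n
toℕ-penultimate n = trans (FP.toℕ-inject₁ (fromℕ n)) (FP.toℕ-fromℕ n)

punchIn-penultimate : ∀ n (y : Fin (suc n)) →
  penultimate n <ᶠ punchIn (penultimate n) y → y ≡ fromℕ n
punchIn-penultimate zero fzero _ = refl
punchIn-penultimate (suc n) (fsuc y) (s≤s lt) = cong fsuc (punchIn-penultimate n y lt)

punchOut-penultimate-last : ∀ n (p : penultimate n ≢ fromℕ (suc n)) → punchOut p ≡ fromℕ n
punchOut-penultimate-last zero p = refl
punchOut-penultimate-last (suc n) p = cong fsuc (punchOut-penultimate-last n (p ∘ cong fsuc))

toℕ-punchOut-below : ∀ {n M} {a b : Fin (suc n)} (a≢b : a ≢ b) →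
  toℕ a ≤ 1 → 1 ≤ M → toℕ b < suc M → toℕ (punchOut a≢b) < M
toℕ-punchOut-below {a = a} {b} a≢b a≤1 1≤M b≤M with ℕP.<-cmp (toℕ a) (toℕ b)
... | tri< a<b _ _ = s≤s⁻¹ (subst (_< suc _) (sym (toℕ-punchOut-> a≢b a<b)) b≤M)
... | tri≈ _ a≡b _ = contradiction (FP.toℕ-injective a≡b) a≢b
... | tri> _ _ b<a =
  subst (_< _) (sym (toℕ-punchOut-< a≢b b<a)) (ℕP.<-≤-trans b<a (ℕP.≤-trans a≤1 1≤M))

-- Deleting and prepending an entry

injective⇒surjective : ∀ {n} {f : Fin n → Fin n} → Injective _≡_ _≡_ f → ∀ y → ∃ λ x → f x ≡ y
injective⇒surjective {suc n} {f} f-inj y with FP.any? (λ x → f x ≟ y)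
... | yes found = found
... | no notFound =
  contradiction (λ {x} {x′} → shrink-injective {x} {x′}) (FP.<⇒notInjective (ℕP.n<1+n n))
  where
  shrink : Fin (suc n) → Fin n
  shrink x = punchOut {i = y} {j = f x} (λ y≡fx → notFound (x , sym y≡fx))
  shrink-injective : Injective _≡_ _≡_ shrink
  shrink-injective eq = f-inj (FP.punchOut-injective {i = y} _ _ eq)

deleteAt : ∀ {n} (j : Fin (suc n)) (f : Fin (suc n) → Fin (suc n)) →
  .(Injective _≡_ _≡_ f) → Fin n → Fin n
deleteAt j f f-inj i =
  punchOut {i = f j} {j = f (punchIn j i)}
    (λ eq → Irrelevant.⊥-elim (FP.punchInᵢ≢i j i (sym (f-inj eq))))

deleteAt-injective : ∀ {n} (j : Fin (suc n)) {f : Fin (suc n) → Fin (suc n)}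
  (f-inj : Injective _≡_ _≡_ f) → Injective _≡_ _≡_ (deleteAt j f f-inj)
deleteAt-injective j {f} f-inj eq =
  FP.punchIn-injective j _ _ (f-inj (FP.punchOut-injective {i = f j} _ _ eq))

prepend : ∀ {n} → Fin (suc n) → (Fin n → Fin n) → Fin (suc n) → Fin (suc n)
prepend v g fzero = v
prepend v g (fsuc i) = punchIn v (g i)

prepend-injective : ∀ {n} (v : Fin (suc n)) {g : Fin n → Fin n} →
  Injective _≡_ _≡_ g → Injective _≡_ _≡_ (prepend v g)
prepend-injective v g-inj {fzero} {fzero} _ = refl
prepend-injective v {g} g-inj {fzero} {fsuc j} eq = contradiction (sym eq) (FP.punchInᵢ≢i v (g j))
prepend-injective v {g} g-inj {fsuc i} {fzero} eq = contradiction eq (FP.punchInᵢ≢i v (g i))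
prepend-injective v g-inj {fsuc i} {fsuc j} eq = cong fsuc (g-inj (FP.punchIn-injective v _ _ eq))

deleteAt-prepend : ∀ {n} {v : Fin (suc n)} {g : Fin n → Fin n} {f : Fin (suc n) → Fin (suc n)}
  .(f-inj : Injective _≡_ _≡_ f) → f ≗ prepend v g → deleteAt fzero f f-inj ≗ g
deleteAt-prepend {v = v} _ f≗ i =
  trans (punchOut-cong₂ (f≗ fzero) (f≗ (fsuc i))) (FP.punchOut-punchIn v)

prepend-deleteAt : ∀ {n} {v : Fin (suc n)} {g : Fin n → Fin n} {f : Fin (suc n) → Fin (suc n)}
  .(f-inj : Injective _≡_ _≡_ f) → f fzero ≡ v → g ≗ deleteAt fzero f f-inj → prepend v g ≗ f
prepend-deleteAt _ f0≡v g≗ fzero = sym f0≡v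
prepend-deleteAt _ refl g≗ (fsuc i) = trans (cong (punchIn _) (g≗ i)) (FP.punchIn-punchOut _)

-- Pattern containment

-- Contains π σ is ContainsF (lookup π) (lookup σ) and AvoidsR n k π is AvoidsF k (lookup π),
-- both definitionally.
ContainsF : ∀ {n a k} → (Fin n → Fin a) → (Fin k → Fin k) → Set
ContainsF {n} {a} {k} f g =
  Σ (Fin k → Fin n) λ e →
    ((i j : Fin k) → i <ᶠ j → e i <ᶠ e j) ×
    ((i j : Fin k) → ((g i <ᶠ g j → f (e i) <ᶠ f (e j)) × (f (e i) <ᶠ f (e j) → g i <ᶠ g j)))

ContainsF-refl : ∀ {k} (g : Fin k → Fin k) → ContainsF g g
ContainsF-refl g = (λ i → i) , (λ _ _ lt → lt) , λ _ _ → (λ lt → lt) , (λ lt → lt)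

ContainsF-transport : ∀ {n a b k} {f : Fin n → Fin a} {f′ : Fin n → Fin b} {g : Fin k → Fin k} →
  (∀ x y → f x <ᶠ f y → f′ x <ᶠ f′ y) → (∀ x y → f′ x <ᶠ f′ y → f x <ᶠ f y) →
  ContainsF f g → ContainsF f′ g
ContainsF-transport to from (e , e-mono , e-ord) =
  e , e-mono , λ i j → to _ _ ∘ proj₁ (e-ord i j) , proj₂ (e-ord i j) ∘ from _ _

ContainsF-≗ : ∀ {n k} {f f′ : Fin n → Fin n} {g : Fin k → Fin k} →
  f ≗ f′ → ContainsF f g → ContainsF f′ g
ContainsF-≗ f≗ = ContainsF-transport (λ x y → subst₂ _<ᶠ_ (f≗ x) (f≗ y))
                                     (λ x y → subst₂ _<ᶠ_ (sym (f≗ x)) (sym (f≗ y)))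

ContainsF-reindex : ∀ {n n′ a k} {f : Fin n → Fin a} {g : Fin k → Fin k} (r : Fin n′ → Fin n) →
  (∀ x y → x <ᶠ y → r x <ᶠ r y) → ContainsF (f ∘ r) g → ContainsF f g
ContainsF-reindex r r-mono (e , e-mono , e-ord) = r ∘ e , (λ i j → r-mono _ _ ∘ e-mono i j) , e-ord

ContainsF-tail : ∀ {n a k} {f : Fin (suc n) → Fin a} {g : Fin (suc k) → Fin (suc k)} →
  (o : ContainsF f g) → proj₁ o fzero ≢ fzero → ContainsF (f ∘ fsuc) g
ContainsF-tail {n} {k = k} {f} {g} (e , e-mono , e-ord) e0≢0 =
  e′ , (λ i j → punchOut-mono-< (0≢e i) (0≢e j) ∘ e-mono i j) , e′-ord
  where
  0≢e : ∀ i → fzero ≢ e i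
  0≢e fzero = e0≢0 ∘ sym
  0≢e (fsuc i) 0≡e = ℕP.n≮0 (subst (e fzero <ᶠ_) (sym 0≡e) (e-mono fzero (fsuc i) (s≤s z≤n)))
  e′ : Fin (suc k) → Fin n
  e′ i = punchOut (0≢e i)
  e′-ord : (i j : Fin (suc k)) →
    (g i <ᶠ g j → f (fsuc (e′ i)) <ᶠ f (fsuc (e′ j))) ×
    (f (fsuc (e′ i)) <ᶠ f (fsuc (e′ j)) → g i <ᶠ g j)
  e′-ord i j = subst₂ (λ x y → (g i <ᶠ g j → f x <ᶠ f y) × (f x <ᶠ f y → g i <ᶠ g j))
    (sym (FP.punchIn-punchOut (0≢e i))) (sym (FP.punchIn-punchOut (0≢e j))) (e-ord i j)

ContainsF-deleteAt : ∀ {n k} (j : Fin (suc n)) {f : Fin (suc n) → Fin (suc n)}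
  .(f-inj : Injective _≡_ _≡_ f) {g : Fin k → Fin k} →
  ContainsF (deleteAt j f f-inj) g → ContainsF f g
ContainsF-deleteAt j {f} f-inj {g} =
  ContainsF-reindex {f = f} (punchIn j) (λ _ _ → punchIn-mono-< j)
    ∘ ContainsF-transport {f = deleteAt j f f-inj} {f′ = f ∘ punchIn j} {g = g}
        (λ _ _ → punchOut-cancel-< {i = f j} _ _) (λ _ _ → punchOut-mono-< {i = f j} _ _)

ContainsF-prepend : ∀ {n k} {v : Fin (suc n)} {g : Fin n → Fin n} {σ : Fin (suc k) → Fin (suc k)} →
  (o : ContainsF (prepend v g) σ) → proj₁ o fzero ≢ fzero → ContainsF g σ
ContainsF-prepend {v = v} {g} o e0≢0 =
  ContainsF-transport {f′ = g} (λ _ _ → punchIn-cancel-< v) (λ _ _ → punchIn-mono-< v)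
    (ContainsF-tail {f = prepend v g} o e0≢0)

¬ContainsF-longer : ∀ {n k} → n < k → (f : Fin n → Fin n) (g : Fin k → Fin k) → ¬ ContainsF f g
¬ContainsF-longer n<k f g (e , e-mono , _) with FP.pigeonhole n<k e
... | i , j , i<j , eᵢ≡eⱼ = ℕP.<⇒≢ (e-mono i j i<j) (cong toℕ eᵢ≡eⱼ)

AvoidsF : ∀ {n} (k : ℕ) → (Fin n → Fin n) → Set
AvoidsF k f = (σ : Vec (Fin k) k) → IsPerm k σ → InR k σ → ¬ ContainsF f (lookup σ)

AvoidsF-≗ : ∀ {n k} {f f′ : Fin n → Fin n} → f ≗ f′ → AvoidsF k f → AvoidsF k f′
AvoidsF-≗ f≗ f-avoids σ σ-perm σ∈R = f-avoids σ σ-perm σ∈R ∘ ContainsF-≗ (sym ∘ f≗)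

AvoidsF-deleteAt : ∀ {n k} (j : Fin (suc n)) {f : Fin (suc n) → Fin (suc n)}
  .(f-inj : Injective _≡_ _≡_ f) → AvoidsF k f → AvoidsF k (deleteAt j f f-inj)
AvoidsF-deleteAt j f-inj f-avoids σ σ-perm σ∈R = f-avoids σ σ-perm σ∈R ∘ ContainsF-deleteAt j f-inj

AvoidsF-shorter : ∀ {n k} → n < k → (f : Fin n → Fin n) → AvoidsF k f
AvoidsF-shorter n<k f σ _ _ = ¬ContainsF-longer n<k f (lookup σ)

IsPerm⇒injective : ∀ {n} {v : Vec (Fin n) n} → IsPerm n v → Injective _≡_ _≡_ (lookup v)
IsPerm⇒injective v-perm {i} {j} = v-perm i j

tabulate-isPerm : ∀ {n} {f : Fin n → Fin n} → Injective _≡_ _≡_ f → IsPerm n (tabulate f)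
tabulate-isPerm {f = f} f-inj i j eq =
  f-inj (trans (sym (lookup∘tabulate f i)) (trans eq (lookup∘tabulate f j)))

InR⇒larger-off-second : ∀ {m} {σ : Vec (Fin (suc (suc m))) (suc (suc m))} → IsPerm _ σ → InR _ σ →
  ∃ λ j → j ≢ fsuc fzero × lookup σ fzero <ᶠ lookup σ j
InR⇒larger-off-second {m} {σ} σ-perm σ∈R
  with injective⇒surjective (IsPerm⇒injective {v = σ} σ-perm) (fromℕ (suc m))
... | jₗ , σjₗ≡last = larger σ∈R
  where
  σjₗ≡1+m : toℕ (lookup σ jₗ) ≡ suc m
  σjₗ≡1+m = trans (cong toℕ σjₗ≡last) (FP.toℕ-fromℕ (suc m))
  larger : InR _ σ → ∃ λ j → j ≢ fsuc fzero × lookup σ fzero <ᶠ lookup σ j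
  larger (inj₂ (σ0≡m , σ1<m)) =
    jₗ , (λ { refl → ℕP.<-asym σ1<m (subst (m <_) (sym σjₗ≡1+m) (ℕP.n<1+n m)) }) ,
    subst₂ _<_ (sym σ0≡m) (sym σjₗ≡1+m) (ℕP.n<1+n m)
  larger (inj₁ σ0<m) with jₗ ≟ fsuc fzero
  ... | no jₗ≢1 = jₗ , jₗ≢1 , subst (_ <_) (sym σjₗ≡1+m) (ℕP.m<n⇒m<1+n σ0<m)
  ... | yes refl with injective⇒surjective (IsPerm⇒injective {v = σ} σ-perm) (penultimate m)
  ...   | jₚ , σjₚ≡pen =
    jₚ , (λ { refl → FP.fromℕ≢inject₁ (trans (sym σjₗ≡last) σjₚ≡pen) }) ,
    subst (_ <_) (sym (trans (cong toℕ σjₚ≡pen) (toℕ-penultimate m))) σ0<m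

-- An occurrence through the first entry would send a pattern entry exceeding the pattern's first
-- one, sitting at a position other than the second, to position 1 of an increasing embedding.
prepend-avoids : ∀ {n} k {v : Fin (suc n)} {g : Fin n → Fin n} → AvoidsF k g →
  (∀ x → v <ᶠ prepend v g x → toℕ x ≡ 1) → AvoidsF k (prepend v g)
prepend-avoids zero _ _ _ _ ()
prepend-avoids (suc zero) _ _ _ _ ()
prepend-avoids (suc (suc m)) {v} {g} g-avoids onlySecondExceeds σ σ-perm σ∈R o@(e , e-mono , e-ord)
  with e fzero ≟ fzero
... | no e0≢0 = g-avoids σ σ-perm σ∈R (ContainsF-prepend o e0≢0)
... | yes e0≡0 with InR⇒larger-off-second {σ = σ} σ-perm σ∈R
...   | j , j≢1 , σ0<σj = noRoom j j≢1 σ0<σj ej≡1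
  where
  ej≡1 : toℕ (e j) ≡ 1
  ej≡1 = onlySecondExceeds (e j)
    (subst (λ x → prepend v g x <ᶠ prepend v g (e j)) e0≡0 (proj₁ (e-ord fzero j) σ0<σj))
  noRoom : ∀ j → j ≢ fsuc fzero → lookup σ fzero <ᶠ lookup σ j → toℕ (e j) ≡ 1 → ⊥
  noRoom fzero _ σ0<σ0 _ = ℕP.<-irrefl refl σ0<σ0
  noRoom (fsuc fzero) j≢1 _ _ = j≢1 refl
  noRoom (fsuc (fsuc i)) _ _ ej≡1 =
    ℕP.<-irrefl refl (ℕP.<-≤-trans
      (subst (_<ᶠ e (fsuc fzero)) e0≡0 (e-mono fzero (fsuc fzero) (s≤s z≤n)))
      (s≤s⁻¹ (subst (toℕ (e (fsuc fzero)) <_) ej≡1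
        (e-mono (fsuc fzero) (fsuc (fsuc i)) (s≤s (s≤s z≤n))))))

prepend-last-avoids : ∀ {n k} {g : Fin n → Fin n} → AvoidsF k g → AvoidsF k (prepend (fromℕ n) g)
prepend-last-avoids {k = k} g-avoids =
  prepend-avoids k g-avoids λ x last<x → contradiction (FP.≤fromℕ _) (ℕP.<⇒≱ last<x)

prepend-penultimate-avoids : ∀ {n k} {g : Fin (suc n) → Fin (suc n)} → Injective _≡_ _≡_ g →
  AvoidsF k g → g fzero ≡ fromℕ n → AvoidsF k (prepend (penultimate n) g)
prepend-penultimate-avoids {n} {k} {g} g-inj g-avoids g0≡last = prepend-avoids k g-avoids onlySecondExceeds
  where
  onlySecondExceeds : ∀ x → penultimate n <ᶠ prepend (penultimate n) g x → toℕ x ≡ 1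
  onlySecondExceeds fzero pen<pen = contradiction pen<pen (ℕP.<-irrefl refl)
  onlySecondExceeds (fsuc y) pen<x =
    cong (toℕ ∘ fsuc) (g-inj (trans (punchIn-penultimate n (g y) pen<x) (sym g0≡last)))

-- The first two entries of an avoider

BadStart : ∀ M → (Fin (suc (suc M)) → Fin (suc (suc M))) → Set
BadStart M f = toℕ (f fzero) < M ⊎ (toℕ (f fzero) ≡ M × toℕ (f (fsuc fzero)) < M)

smallValueOtherThan : ∀ {n} (b : Fin (suc (suc n))) → Σ (Fin (suc (suc n))) λ v → v ≢ b × toℕ v ≤ 1
smallValueOtherThan fzero = fsuc fzero , (λ ()) , s≤s z≤n
smallValueOtherThan (fsuc b) = fzero , (λ ()) , z≤n

BadStart-deleteAt : ∀ {M} → 1 ≤ M → (f : Fin (suc (suc (suc M))) → Fin (suc (suc (suc M))))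
  (f-inj : Injective _≡_ _≡_ f) → BadStart (suc M) f → ∃ λ q → BadStart M (deleteAt q f f-inj)
BadStart-deleteAt 1≤M f f-inj (inj₁ f0<1+M) with smallValueOtherThan (f fzero)
... | v , v≢f0 , v≤1 with injective⇒surjective f-inj v
...   | fzero , f0≡v = contradiction (sym f0≡v) v≢f0
...   | fsuc q , fq≡v =
  fsuc q , inj₁ (toℕ-punchOut-below _ (subst (λ x → toℕ x ≤ 1) (sym fq≡v) v≤1) 1≤M f0<1+M)
BadStart-deleteAt {M} 1≤M f f-inj (inj₂ (f0≡1+M , f1<1+M)) with smallValueOtherThan (f (fsuc fzero))
... | v , v≢f1 , v≤1 with injective⇒surjective f-inj v
...   | fzero , f0≡v =
  contradiction (subst (_≤ 1) f0≡1+M (subst (λ x → toℕ x ≤ 1) (sym f0≡v) v≤1)) (ℕP.<⇒≱ (s≤s 1≤M))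
...   | fsuc fzero , f1≡v = contradiction (sym f1≡v) v≢f1
...   | fsuc (fsuc q) , fq≡v =
  fsuc (fsuc q) ,
  inj₂ (ℕP.suc-injective (trans (toℕ-punchOut-> _ fq<f0) f0≡1+M) , toℕ-punchOut-below _ fq≤1 1≤M f1<1+M)
  where
  fq≤1 : toℕ (f (fsuc (fsuc q))) ≤ 1
  fq≤1 = subst (λ x → toℕ x ≤ 1) (sym fq≡v) v≤1
  fq<f0 : f (fsuc (fsuc q)) <ᶠ f fzero
  fq<f0 = subst (toℕ (f (fsuc (fsuc q))) <_) (sym f0≡1+M) (s≤s (ℕP.≤-trans fq≤1 1≤M))

-- For M = m, BadStart m f is InR (tabulate f) itself.
badStart-not-avoids : ∀ {m} → 1 ≤ m → ∀ {M} → m ≤ M → (f : Fin (suc (suc M)) → Fin (suc (suc M))) →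
  Injective _≡_ _≡_ f → BadStart M f → ¬ AvoidsF (suc (suc m)) f
badStart-not-avoids 1≤m m≤M f f-inj bad f-avoids with ℕP.m≤n⇒m<n∨m≡n m≤M
... | inj₂ refl = AvoidsF-≗ (sym ∘ lookup∘tabulate f) f-avoids (tabulate f) (tabulate-isPerm f-inj) bad
                    (ContainsF-refl (lookup (tabulate f)))
... | inj₁ (s≤s m≤M′) with BadStart-deleteAt (ℕP.≤-trans 1≤m m≤M′) f f-inj bad
...   | q , bad′ = badStart-not-avoids 1≤m m≤M′ (deleteAt q f f-inj) (deleteAt-injective q f-inj) bad′
                     (AvoidsF-deleteAt q f-inj f-avoids)

HighStart : ∀ M → (Fin (suc (suc M)) → Fin (suc (suc M))) → Set
HighStart M f =
  f fzero ≡ fromℕ (suc M) ⊎ (f fzero ≡ penultimate M × f (fsuc fzero) ≡ fromℕ (suc M))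

highStart? : ∀ {M} (f : Fin (suc (suc M)) → Fin (suc (suc M))) → Dec (HighStart M f)
highStart? f = (f fzero ≟ _) ⊎-dec ((f fzero ≟ _) ×-dec (f (fsuc fzero) ≟ _))

¬HighStart⇒BadStart : ∀ {M} {f : Fin (suc (suc M)) → Fin (suc (suc M))} →
  Injective _≡_ _≡_ f → ¬ HighStart M f → BadStart M f
¬HighStart⇒BadStart {M} {f} f-inj ¬high with ℕP.<-cmp (toℕ (f fzero)) M
... | tri< f0<M _ _ = inj₁ f0<M
... | tri≈ _ f0≡M _ = inj₂ (f0≡M , ℕP.≤∧≢⇒< (s≤s⁻¹ (ℕP.≤∧≢⇒< (s≤s⁻¹ (FP.toℕ<n _)) f1≢1+M)) f1≢M)
  where
  f1≢1+M : toℕ (f (fsuc fzero)) ≢ suc M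
  f1≢1+M f1≡1+M = ¬high (inj₂ ( FP.toℕ-injective (trans f0≡M (sym (toℕ-penultimate M)))
                              , FP.toℕ-injective (trans f1≡1+M (sym (FP.toℕ-fromℕ (suc M))))))
  f1≢M : toℕ (f (fsuc fzero)) ≢ M
  f1≢M f1≡M with f-inj (FP.toℕ-injective (trans f1≡M (sym f0≡M)))
  ... | ()
... | tri> _ _ M<f0 = contradiction (inj₁ f0≡last) ¬high
  where
  f0≡last : f fzero ≡ fromℕ (suc M)
  f0≡last =
    FP.toℕ-injective (trans (ℕP.≤-antisym (s≤s⁻¹ (FP.toℕ<n _)) M<f0) (sym (FP.toℕ-fromℕ (suc M))))

-- S_n(R) by first entry

module _ {k : ℕ} where

  tabulateSnR : ∀ {n} (f : Fin n → Fin n) → .(Injective _≡_ _≡_ f) → .(AvoidsF k f) → SnR n k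
  tabulateSnR f f-inj f-avoids =
    mkSnR (tabulate f) (tabulate-isPerm f-inj) (AvoidsF-≗ (sym ∘ lookup∘tabulate f) f-avoids)

  SnR-ext : ∀ {n} {π ρ : SnR n k} → lookup (SnR.perm π) ≗ lookup (SnR.perm ρ) → π ≡ ρ
  SnR-ext {π = mkSnR π _ _} {mkSnR ρ _ _} π≗ρ
    with trans (sym (tabulate∘lookup π)) (trans (tabulate-cong π≗ρ) (tabulate∘lookup ρ))
  ... | refl = refl

  head : ∀ {n} → SnR (suc n) k → Fin (suc n)
  head π = lookup (SnR.perm π) fzero

  tail : ∀ {n} → SnR (suc n) k → SnR n k
  tail (mkSnR π π-perm π-avoids) =
    tabulateSnR (deleteAt fzero (lookup π) (IsPerm⇒injective {v = π} π-perm))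
      (deleteAt-injective fzero (IsPerm⇒injective {v = π} π-perm))
      (AvoidsF-deleteAt fzero (IsPerm⇒injective {v = π} π-perm) π-avoids)

  PrependPreserves : ∀ {n} → Fin (suc n) → (Fin n → Fin n) → Set
  PrependPreserves v g = Injective _≡_ _≡_ g → AvoidsF k g → AvoidsF k (prepend v g)

  -- The fields of an SnR are irrelevant, so they are only available under a pattern match on
  -- mkSnR; cons therefore asks how avoidance propagates instead of for the avoidance itself.
  cons : ∀ {n} (v : Fin (suc n)) (ρ : SnR n k) → .(PrependPreserves v (lookup (SnR.perm ρ))) →
    SnR (suc n) k
  cons v (mkSnR ρ ρ-perm ρ-avoids) preserves =
    tabulateSnR (prepend v (lookup ρ)) (prepend-injective v (IsPerm⇒injective {v = ρ} ρ-perm))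
      (preserves (IsPerm⇒injective {v = ρ} ρ-perm) ρ-avoids)

  tail-cons : ∀ {n} (v : Fin (suc n)) (ρ : SnR n k)
    .(preserves : PrependPreserves v (lookup (SnR.perm ρ))) → tail (cons v ρ preserves) ≡ ρ
  tail-cons v (mkSnR ρ ρ-perm _) _ = SnR-ext λ i →
    trans (lookup∘tabulate _ i)
          (deleteAt-prepend (IsPerm⇒injective {v = tabulate (prepend v (lookup ρ))}
                              (tabulate-isPerm (prepend-injective v (IsPerm⇒injective {v = ρ} ρ-perm))))
                            (lookup∘tabulate (prepend v (lookup ρ))) i)

  cons-tail : ∀ {n} {v : Fin (suc n)} (π : SnR (suc n) k) → head π ≡ v →
    .(preserves : PrependPreserves v (lookup (SnR.perm (tail π)))) → cons v (tail π) preserves ≡ π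
  cons-tail {v = v} π@(mkSnR f f-perm _) f0≡v _ = SnR-ext λ i →
    trans (lookup∘tabulate (prepend v (lookup (SnR.perm (tail π)))) i)
          (prepend-deleteAt (IsPerm⇒injective {v = f} f-perm) f0≡v (lookup∘tabulate _) i)

  SnR-head-tail : ∀ {n} → suc n < k → SnR (suc n) k ↔ (Fin (suc n) × SnR n k)
  SnR-head-tail {n} 1+n<k =
    mk↔ₛ′ (λ π → head π , tail π) (λ (v , ρ) → cons v ρ (shorter v _))
      (λ (v , ρ) → cong (v ,_) (tail-cons v ρ (shorter v _))) (λ π → cons-tail π refl (shorter (head π) _))
    where
    shorter : (v : Fin (suc n)) (g : Fin n → Fin n) → PrependPreserves v g
    shorter v g _ _ = AvoidsF-shorter 1+n<k (prepend v g)

  SnR-shorter : ∀ {n} → n < k → Fin (n !) ↔ SnR n k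
  SnR-shorter {zero} 0<k =
    mk↔ₛ′ (λ _ → empty) (λ _ → fzero) (λ { (mkSnR [] _ _) → refl }) λ { fzero → refl ; (fsuc ()) }
    where
    empty : SnR 0 k
    empty = mkSnR [] (λ ()) (AvoidsF-shorter 0<k (lookup []))
  SnR-shorter {suc n} 1+n<k =
    ↔-sym (SnR-head-tail 1+n<k) ↔-∘ ((↔-id _ ×-↔ SnR-shorter (ℕP.<-trans (ℕP.n<1+n n) 1+n<k)) ↔-∘ FP.*↔×)

  lastPreserves : ∀ {n} (g : Fin n → Fin n) → PrependPreserves (fromℕ n) g
  lastPreserves g _ = prepend-last-avoids

  penultimatePreserves : ∀ {n} (g : Fin (suc n) → Fin (suc n)) → g fzero ≡ fromℕ n →
    PrependPreserves (penultimate n) g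
  penultimatePreserves g g0≡last g-inj g-avoids = prepend-penultimate-avoids g-inj g-avoids g0≡last

  consLast : ∀ {n} → SnR n k → SnR (suc n) k
  consLast ρ = cons (fromℕ _) ρ (lastPreserves _)

  consPenultimate : ∀ {n} (ρ : SnR (suc n) k) → .(head ρ ≡ fromℕ n) → SnR (suc (suc n)) k
  consPenultimate ρ ρ0≡last = cons (penultimate _) ρ (penultimatePreserves _ ρ0≡last)

  consPenultimate-cong : ∀ {n} {ρ ρ′ : SnR (suc n) k} → ρ ≡ ρ′ →
    .(ρ0≡last : head ρ ≡ fromℕ n) .(ρ′0≡last : head ρ′ ≡ fromℕ n) →
    consPenultimate ρ ρ0≡last ≡ consPenultimate ρ′ ρ′0≡last
  consPenultimate-cong refl _ _ = refl

  head-tail : ∀ {n} (π : SnR (suc (suc n)) k) → head π ≡ penultimate n →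
    lookup (SnR.perm π) (fsuc fzero) ≡ fromℕ (suc n) → head (tail π) ≡ fromℕ n
  head-tail {n} (mkSnR _ _ _) π0≡pen π1≡last =
    trans (punchOut-cong₂ π0≡pen π1≡last) (punchOut-penultimate-last n (FP.fromℕ≢inject₁ ∘ sym))

-- The case split is decided rather than derived from avoidance, because avoidance is irrelevant;
-- avoidance only rules out the remaining case.
avoider-highStart : ∀ {m} → 1 ≤ m → ∀ {M} → m ≤ M →
  (π : SnR (suc (suc M)) (suc (suc m))) → HighStart M (lookup (SnR.perm π))
avoider-highStart 1≤m m≤M (mkSnR π π-perm π-avoids) with highStart? (lookup π)
... | yes high = high
... | no ¬high = Irrelevant.⊥-elim
  (badStart-not-avoids 1≤m m≤M (lookup π) (IsPerm⇒injective {v = π} π-perm)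
    (¬HighStart⇒BadStart (IsPerm⇒injective {v = π} π-perm) ¬high) π-avoids)

SnR-step : ∀ {m} → 1 ≤ m → ∀ {M} → m ≤ M →
  SnR (suc (suc M)) (suc (suc m)) ↔ (SnR (suc M) (suc (suc m)) ⊎ SnR M (suc (suc m)))
SnR-step {m} 1≤m {M} m≤M = mk↔ₛ′ to from to∘from from∘to
  where
  K : ℕ
  K = suc (suc m)

  split : (π : SnR (suc (suc M)) K) → HighStart M (lookup (SnR.perm π)) → SnR (suc M) K ⊎ SnR M K
  split π (inj₁ _) = inj₁ (tail π)
  split π (inj₂ _) = inj₂ (tail (tail π))

  to : SnR (suc (suc M)) K → SnR (suc M) K ⊎ SnR M K
  to π = split π (avoider-highStart 1≤m m≤M π)

  from : SnR (suc M) K ⊎ SnR M K → SnR (suc (suc M)) K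
  from (inj₁ ρ) = consLast ρ
  from (inj₂ ρ) = consPenultimate (consLast ρ) refl

  from∘split : ∀ π (high : HighStart M (lookup (SnR.perm π))) → from (split π high) ≡ π
  from∘split π (inj₁ π0≡last) = cons-tail π π0≡last (lastPreserves _)
  from∘split π (inj₂ (π0≡pen , π1≡last)) =
    trans (consPenultimate-cong (cons-tail (tail π) tail0≡last (lastPreserves _)) refl tail0≡last)
          (cons-tail π π0≡pen (penultimatePreserves _ tail0≡last))
    where
    tail0≡last : head (tail π) ≡ fromℕ M
    tail0≡last = head-tail π π0≡pen π1≡last

  from∘to : ∀ π → from (to π) ≡ π
  from∘to π = from∘split π (avoider-highStart 1≤m m≤M π)

  to∘from : ∀ ρ → to (from ρ) ≡ ρ
  to∘from (inj₁ ρ) with avoider-highStart 1≤m m≤M (from (inj₁ ρ))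
  ... | inj₁ _ = cong inj₁ (tail-cons _ ρ (lastPreserves _))
  ... | inj₂ (last≡pen , _) = contradiction last≡pen FP.fromℕ≢inject₁
  to∘from (inj₂ ρ) with avoider-highStart 1≤m m≤M (from (inj₂ ρ))
  ... | inj₁ pen≡last = contradiction (sym pen≡last) FP.fromℕ≢inject₁
  ... | inj₂ _ =
    cong inj₂ (trans (cong tail (tail-cons _ (consLast ρ) (penultimatePreserves _ refl)))
                     (tail-cons _ ρ (lastPreserves _)))

-- Counting

fibFrom : ℕ → ℕ → ℕ → ℕ
fibFrom a b zero = a
fibFrom a b (suc zero) = b
fibFrom a b (suc (suc d)) = fibFrom a b (suc d) + fibFrom a b d

fibFrom-F : ∀ a b d → fibFrom a b (suc d) ≡ F d * a + F (suc d) * b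
fibFrom-F a b zero = sym (ℕP.+-identityʳ b)
fibFrom-F a b (suc zero) = solve 2 (λ a b → b :+ a := con 1 :* a :+ con 1 :* b) refl a b
  where open +-*-Solver
fibFrom-F a b (suc (suc d)) = begin
  fibFrom a b (3 + d)
    ≡⟨ cong₂ _+_ (fibFrom-F a b (suc d)) (fibFrom-F a b d) ⟩
  (F (suc d) * a + F (2 + d) * b) + (F d * a + F (suc d) * b)
    ≡⟨ solve 4 (λ a b x y → (x :* a :+ (x :+ y) :* b) :+ (y :* a :+ x :* b)
                          := (x :+ y) :* a :+ ((x :+ y) :+ x) :* b)
               refl a b (F (suc d)) (F d) ⟩
  F (2 + d) * a + F (3 + d) * b
    ∎
  where
  open ≡-Reasoning
  open +-*-Solver

↔-fibFrom : ∀ {a b} (A : ℕ → Set) → Fin a ↔ A 0 → Fin b ↔ A 1 →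
  (∀ d → A (suc (suc d)) ↔ (A (suc d) ⊎ A d)) → ∀ d → Fin (fibFrom a b d) ↔ A d
↔-fibFrom {a} {b} A A₀ A₁ step d = proj₁ (consecutive d)
  where
  consecutive : ∀ d → (Fin (fibFrom a b d) ↔ A d) × (Fin (fibFrom a b (suc d)) ↔ A (suc d))
  consecutive zero = A₀ , A₁
  consecutive (suc d) with consecutive d
  ... | A-d , A-1+d = A-1+d , ↔-sym (step d) ↔-∘ ((A-1+d ⊎-↔ A-d) ↔-∘ FP.+↔⊎)

SnR-fibFrom : ∀ {m} → 1 ≤ m → ∀ d → Fin (fibFrom (m !) (suc m !) d) ↔ SnR (d + m) (suc (suc m))
SnR-fibFrom {m} 1≤m = ↔-fibFrom (λ d → SnR (d + m) (suc (suc m)))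
  (SnR-shorter (ℕP.n≤1+n (suc m))) (SnR-shorter (ℕP.n<1+n (suc m)))
  (λ d → SnR-step 1≤m (ℕP.m≤n+m m d))

fibFrom-factorials : ∀ j d →
  fibFrom (suc j !) (suc (suc j) !) (2 + d) ≡ suc j ! * (F (d + 4) + j * F (d + 2))
fibFrom-factorials j d = begin
  fibFrom a (suc (suc j) * a) (2 + d)
    ≡⟨ fibFrom-F a _ (suc d) ⟩
  F (suc d) * a + F (2 + d) * (suc (suc j) * a)
    ≡⟨ solve 4 (λ a j x y → x :* a :+ (x :+ y) :* ((con 2 :+ j) :* a)
                          := a :* ((((x :+ y) :+ x) :+ (x :+ y)) :+ j :* (x :+ y)))
               refl a j (F (suc d)) (F d) ⟩
  a * (F (4 + d) + j * F (2 + d))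
    ≡⟨ cong₂ (λ p q → a * (F p + j * F q)) (ℕP.+-comm 4 d) (ℕP.+-comm 2 d) ⟩
  a * (F (d + 4) + j * F (d + 2))
    ∎
  where
  a : ℕ
  a = suc j !
  open ≡-Reasoning
  open +-*-Solver

mainTheorem19 : (k : ℕ) → 3 ≤ k → (n : ℕ) → k ≤ n →
    Fin ((k ∸ 2) ! * (F (n ∸ k + 4) + (k ∸ 3) * F (n ∸ k + 2))) ↔ SnR n k
mainTheorem19 (suc (suc (suc j))) (s≤s (s≤s (s≤s _))) n k≤n =
  subst₂ (λ c l → Fin c ↔ SnR l (3 + j)) (fibFrom-factorials j d) length≡n
    (SnR-fibFrom (s≤s z≤n) (2 + d))
  where
  open +-*-Solver
  d : ℕ
  d = n ∸ (3 + j)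
  length≡n : 2 + d + suc j ≡ n
  length≡n = trans (solve 2 (λ d j → con 2 :+ d :+ (con 1 :+ j) := d :+ (con 3 :+ j)) refl d j)
                   (ℕP.m∸n+n≡m k≤n)
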